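{- $f_0(1)=0$, and for every integer $N\ge3$, \[f_0(N)=\left\lceil \tfrac N2\right\rceil-1+f_0\!\left(\left\lceil \tfrac N2\right\rceil-1\right).\]
   Context: Unlabeled chip-firing on the infinite rooted binary tree (every vertex has a left and a right child) with a self-loop at the root. Start with $N$ indistinguishable chips at the root. A vertex with at least $3$ chips may fire, sending one chip to each child and one to its parent (the root keeps that chip via its self-loop). The process reaches a unique stable configuration, and the number of times each vertex fires is independent of the order of fires. $f_0(N)$ denotes the number of times the root fires when starting with $N$ chips. -}

module Defs where

open import Data.Bool using (Bool; true; false; if_then_else_)
open import Data.Bool.Properties using () renaming (_≟_ to _≟B_)
open import Data.List using (List; []; _∷_)
open import Data.List.Properties using (≡-dec)
open import Data.Nat using (ℕ; zero; suc; _+_; _∸_; _≤_; _<_)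
open import Data.Product using (Σ; _×_; _,_)
open import Relation.Binary.PropositionalEquality using (_≡_)
open import Relation.Nullary using (Dec; yes; no)

-- A vertex of the infinite rooted binary tree is the path from the root,
-- stored with the LAST step at the head: the children of v are
-- (false ∷ v) (left) and (true ∷ v) (right); the root is [].
Vertex : Set
Vertex = List Bool

_≟V_ : (u v : Vertex) → Dec (u ≡ v)
_≟V_ = ≡-dec _≟B_

root : Vertex
root = []

-- parent; the root's "parent" is the root itself (the self-loop).
parent : Vertex → Vertex
parent []      = []
parent (_ ∷ v) = v

Config : Set
Config = Vertex → ℕ

initial : ℕ → Config
initial N w with w ≟V root
... | yes _ = N
... | no  _ = 0

ind : {A : Set} → Dec A → ℕ
ind (yes _) = 1
ind (no  _) = 0

-- chips received by w when v fires: one to each child, one to the parent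
-- (for the root, the parent chip returns to the root via the self-loop)
gain : Vertex → Vertex → ℕ
gain v w = ind (w ≟V (false ∷ v)) + ind (w ≟V (true ∷ v)) + ind (w ≟V parent v)

-- firing v (only applied when v has at least 3 chips)
fire : Vertex → Config → Config
fire v c w with w ≟V v
... | yes _ = (c w ∸ 3) + gain v w
... | no  _ = c w + gain v w

data Run : Config → List Vertex → Config → Set where
  done : ∀ {c} → Run c [] c
  step : ∀ {c c' vs} (v : Vertex) → 3 ≤ c v → Run (fire v c) vs c' → Run c (v ∷ vs) c'

Stable : Config → Set
Stable c = ∀ v → c v < 3

rootCount : List Vertex → ℕ
rootCount []       = 0
rootCount (v ∷ vs) = ind (v ≟V root) + rootCount vs

-- RootFires N k : some legal firing sequence from N chips at the root reaches
-- a stable configuration, and the root fires exactly k times in it.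
-- (By the order-independence result, f₀(N) = k iff RootFires N k.)
RootFires : ℕ → ℕ → Set
RootFires N k = Σ (List Vertex) λ vs → Σ Config λ c →
  Run (initial N) vs c × Stable c × rootCount vs ≡ k

-- Firing the root ⌈N/2⌉ − 1 times leaves r ∈ {1, 2} chips at the root and ⌈N/2⌉ − 1 chips
-- at each child, i.e. a copy of the initial configuration with ⌈N/2⌉ − 1 chips in each
-- subtree. Every firing of that smaller game is simulated by firing both copies of the
-- vertex (plus the root, when the simulated vertex is the root), and the root keeps r < 3
-- chips throughout, so the simulation stabilises exactly when the smaller game does.
-- Root firings counted this way do not depend on the chosen stabilising sequence, by the
-- least action principle: any legal sequence is a sub-multiset of every stabilising one.
module Submission where

open import Defs
open import Data.Bool using (Bool; true; false)
open import Data.Empty using (⊥-elim)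
open import Data.List using (List; []; _∷_; _++_; _∷ʳ_; [_]; map; replicate; concatMap; length)
open import Data.List.Properties using (length-++; ∷ʳ-injectiveʳ)
open import Data.List.Relation.Binary.Permutation.Propositional
  using (_↭_; ↭-refl; ↭-sym; ↭-trans; prep; swap)
open import Data.List.Relation.Binary.Permutation.Propositional.Properties
  using (shift; ↭-length; map⁺; ++-identityʳ)
open import Data.List.Relation.Unary.All using (All; []; _∷_)
open import Data.Nat using (ℕ; zero; suc; _+_; _*_; _∸_; _≤_; _<_; z≤n; s≤s; ⌊_/2⌋; ⌈_/2⌉)
open import Data.Nat.Induction using (<-rec)
open import Data.Nat.ListAction using (sum)
open import Data.Nat.ListAction.Properties using (sum-↭)
open import Data.Nat.Properties
  using (+-identityʳ; +-assoc; +-suc; +-commutativeSemigroup; *-identityˡ; *-identityʳ; *-zeroʳ;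
         *-distribˡ-+; +-cancelʳ-≡; +-mono-≤; +-monoˡ-≤; *-monoʳ-≤; m≤m+n; ≤-trans;
         ≤-refl; <⇒≱; m∸n+n≡m; m+1+n≢m; ⌊n/2⌋≤n)
open import Algebra.Properties.CommutativeSemigroup +-commutativeSemigroup using (xy∙z≈xz∙y)
open import Data.Nat.Tactic.RingSolver using (solve-∀)
open import Data.Product using (_×_; _,_; ∃-syntax)
open import Data.Unit using (⊤)
open import Function.Bundles using (_⇔_; mk⇔)
open import Relation.Binary.PropositionalEquality
  using (_≡_; _≢_; refl; sym; trans; cong; cong₂; subst; ≢-sym; module ≡-Reasoning)
open import Relation.Nullary using (yes; no)

open ≡-Reasoning

private
  variable
    r n k k′ : ℕ
    v w x : Vertex
    c d : Config
    vs ws α β : List Vertex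

-- A structural version of ind (u ≟V v): it computes on open terms.
δᵇ : Bool → Bool → ℕ
δᵇ false false = 1
δᵇ true  true  = 1
δᵇ false true  = 0
δᵇ true  false = 0

δ : Vertex → Vertex → ℕ
δ []      []      = 1
δ []      (_ ∷ _) = 0
δ (_ ∷ _) []      = 0
δ (a ∷ u) (b ∷ v) = δᵇ a b * δ u v

δ-refl : ∀ u → δ u u ≡ 1
δ-refl []          = refl
δ-refl (false ∷ u) = trans (*-identityˡ (δ u u)) (δ-refl u)
δ-refl (true  ∷ u) = trans (*-identityˡ (δ u u)) (δ-refl u)

δ-≢ : ∀ u v → u ≢ v → δ u v ≡ 0
δ-≢ []          []          u≢v = ⊥-elim (u≢v refl)
δ-≢ []          (_ ∷ _)     _   = refl
δ-≢ (_ ∷ _)     []          _   = refl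
δ-≢ (false ∷ u) (false ∷ v) u≢v = trans (*-identityˡ (δ u v)) (δ-≢ u v (λ u≡v → u≢v (cong (false ∷_) u≡v)))
δ-≢ (true  ∷ u) (true  ∷ v) u≢v = trans (*-identityˡ (δ u v)) (δ-≢ u v (λ u≡v → u≢v (cong (true ∷_) u≡v)))
δ-≢ (false ∷ _) (true  ∷ _) _   = refl
δ-≢ (true  ∷ _) (false ∷ _) _   = refl

ind-≟V : ∀ u v → ind (u ≟V v) ≡ δ u v
ind-≟V u v with u ≟V v
... | yes refl = sym (δ-refl u)
... | no  u≢v  = sym (δ-≢ u v u≢v)

gain-δ : ∀ v x → gain v x ≡ δ x (false ∷ v) + δ x (true ∷ v) + δ x (parent v)
gain-δ v x = cong₂ _+_ (cong₂ _+_ (ind-≟V x (false ∷ v)) (ind-≟V x (true ∷ v))) (ind-≟V x (parent v))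

fire-balance : 3 ≤ c v → ∀ x → fire v c x + 3 * δ x v ≡ c x + gain v x
fire-balance {c} {v} c≥3 x with x ≟V v
... | yes refl = begin
  c x ∸ 3 + gain x x + 3 * δ x x ≡⟨ cong (λ m → c x ∸ 3 + gain x x + 3 * m) (δ-refl x) ⟩
  c x ∸ 3 + gain x x + 3         ≡⟨ xy∙z≈xz∙y (c x ∸ 3) (gain x x) 3 ⟩
  c x ∸ 3 + 3 + gain x x         ≡⟨ cong (_+ gain x x) (m∸n+n≡m c≥3) ⟩
  c x + gain x x                 ∎
... | no x≢v = trans (cong (λ m → c x + gain v x + 3 * m) (δ-≢ x v x≢v)) (+-identityʳ _)

fire-mono : x ≢ v → c x ≤ fire v c x
fire-mono {x} {v} {c} x≢v with x ≟V v
... | yes x≡v = ⊥-elim (x≢v x≡v)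
... | no  _   = m≤m+n (c x) (gain v x)

apply : List Vertex → Config → Config
apply []       c = c
apply (v ∷ vs) c = apply vs (fire v c)

Legal : Config → List Vertex → Set
Legal c []       = ⊤
Legal c (v ∷ vs) = 3 ≤ c v × Legal (fire v c) vs

_≈_ : Config → Config → Set
c ≈ d = ∀ x → c x ≡ d x

stable-≈ : c ≈ d → Stable c → Stable d
stable-≈ c≈d stable v = subst (_< 3) (c≈d v) (stable v)

fire-cong : c ≈ d → fire v c ≈ fire v d
fire-cong {c} {d} {v} c≈d x with x ≟V v
... | yes _ = cong (λ m → m ∸ 3 + gain v x) (c≈d x)
... | no  _ = cong (_+ gain v x) (c≈d x)

legal-cong : c ≈ d → Legal c vs → Legal d vs
legal-cong {vs = []}     _   _              = _
legal-cong {vs = v ∷ vs} c≈d (c≥3 , legal) =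
  subst (3 ≤_) (c≈d v) c≥3 , legal-cong (fire-cong c≈d) legal

legal-++ : Legal c α → Legal (apply α c) β → Legal c (α ++ β)
legal-++ {α = []}    _             legal  = legal
legal-++ {α = _ ∷ _} (c≥3 , legal) legal′ = c≥3 , legal-++ legal legal′

apply-++ : ∀ α β c → apply (α ++ β) c ≡ apply β (apply α c)
apply-++ []      β c = refl
apply-++ (v ∷ α) β c = apply-++ α β (fire v c)

run⇒legal : Run c vs d → Legal c vs
run⇒legal done           = _
run⇒legal (step _ h run) = h , run⇒legal run

run⇒apply : Run c vs d → d ≡ apply vs c
run⇒apply done           = refl
run⇒apply (step _ _ run) = run⇒apply run

legal⇒run : Legal c vs → Run c vs (apply vs c)
legal⇒run {vs = []}     _             = done
legal⇒run {vs = v ∷ vs} (c≥3 , legal) = step v c≥3 (legal⇒run legal)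

-- The abelian property

firings : Vertex → List Vertex → ℕ
firings x vs = sum (map (δ x) vs)

inflow : List Vertex → Vertex → ℕ
inflow vs x = sum (map (λ v → gain v x) vs)

apply-balance : Legal c vs → ∀ x → apply vs c x + 3 * firings x vs ≡ c x + inflow vs x
apply-balance {c} {[]}     _             x = trans (+-identityʳ (c x)) (sym (+-identityʳ (c x)))
apply-balance {c} {v ∷ vs} (c≥3 , legal) x = begin
  apply vs (fire v c) x + 3 * (δ x v + firings x vs)    ≡⟨ regroup (apply vs (fire v c) x) (δ x v) (firings x vs) ⟩
  apply vs (fire v c) x + 3 * firings x vs + 3 * δ x v  ≡⟨ cong (_+ 3 * δ x v) (apply-balance legal x) ⟩
  fire v c x + inflow vs x + 3 * δ x v                  ≡⟨ xy∙z≈xz∙y (fire v c x) _ _ ⟩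
  fire v c x + 3 * δ x v + inflow vs x                  ≡⟨ cong (_+ inflow vs x) (fire-balance c≥3 x) ⟩
  c x + gain v x + inflow vs x                          ≡⟨ +-assoc (c x) _ _ ⟩
  c x + (gain v x + inflow vs x)                        ∎
  where
  regroup : ∀ a b f → a + 3 * (b + f) ≡ a + 3 * f + 3 * b
  regroup = solve-∀

apply-↭ : Legal c vs → Legal c ws → vs ↭ ws → apply vs c ≈ apply ws c
apply-↭ {c} {vs} {ws} legal legal′ vs↭ws x = +-cancelʳ-≡ (3 * firings x ws) _ _ (begin
  apply vs c x + 3 * firings x ws  ≡⟨ cong (λ m → apply vs c x + 3 * m) (sum-↭ (map⁺ (δ x) (↭-sym vs↭ws))) ⟩
  apply vs c x + 3 * firings x vs  ≡⟨ apply-balance legal x ⟩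
  c x + inflow vs x                ≡⟨ cong (c x +_) (sum-↭ (map⁺ (λ v → gain v x) vs↭ws)) ⟩
  c x + inflow ws x                ≡⟨ apply-balance legal′ x ⟨
  apply ws c x + 3 * firings x ws  ∎)

fire-comm : 3 ≤ c v → 3 ≤ c w → v ≢ w → fire w (fire v c) ≈ fire v (fire w c)
fire-comm {c} {v} {w} c≥3 c≥3′ v≢w =
  apply-↭ {vs = v ∷ w ∷ []} {ws = w ∷ v ∷ []}
          (c≥3  , ≤-trans c≥3′ (fire-mono {c = c} (≢-sym v≢w)) , _)
          (c≥3′ , ≤-trans c≥3  (fire-mono {c = c} v≢w) , _)
          (swap _ _ ↭-refl)

legal-fire-first : 3 ≤ c v → All (_≢ v) α → Legal c (α ++ v ∷ β) → Legal (fire v c) (α ++ β)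
legal-fire-first c≥3 []          (_ , legal)     = legal
legal-fire-first c≥3 (w≢v ∷ w∉α) (c≥3′ , legal) =
  ≤-trans c≥3′ (fire-mono w≢v) ,
  legal-cong (fire-comm c≥3′ c≥3 w≢v)
             (legal-fire-first (≤-trans c≥3 (fire-mono (≢-sym w≢v))) w∉α legal)

-- A vertex that can fire must fire in every stabilising sequence, since the other
-- firings only add chips to it.
first-firing : 3 ≤ c v → Legal c β → Stable (apply β c) →
               ∃[ β₁ ] ∃[ β₂ ] (β ≡ β₁ ++ v ∷ β₂ × All (_≢ v) β₁)
first-firing {v = v} {β = []}    c≥3 _           stable = ⊥-elim (<⇒≱ (stable v) c≥3)
first-firing {v = v} {β = w ∷ β} c≥3 (_ , legal) stable with w ≟V v
... | yes refl = [] , β , refl , []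
... | no  w≢v with first-firing {v = v} (≤-trans c≥3 (fire-mono (≢-sym w≢v))) legal stable
...   | β₁ , β₂ , refl , v∉β₁ = w ∷ β₁ , β₂ , refl , w≢v ∷ v∉β₁

least-action : Legal c α → Legal c β → Stable (apply β c) → ∃[ γ ] β ↭ α ++ γ
least-action {α = []}    {β = β} _ _ _ = β , ↭-refl
least-action {α = v ∷ α} (c≥3 , legal) legal′ stable with first-firing c≥3 legal′ stable
... | β₁ , β₂ , refl , v∉β₁ =
  let legal″ = legal-fire-first c≥3 v∉β₁ legal′
      same   = apply-↭ legal′ (c≥3 , legal″) (shift v β₁ β₂)
      γ , p  = least-action legal legal″ (stable-≈ same stable)
  in  γ , ↭-trans (shift v β₁ β₂) (prep v p)

stabilising-↭ : Legal c α → Legal c β → Stable (apply α c) → Stable (apply β c) → α ↭ β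
stabilising-↭ {α = α} {β = β} legal legal′ stable stable′
  with least-action legal legal′ stable′ | least-action legal′ legal stable
... | []    , β↭α   | _ = ↭-sym (↭-trans β↭α (++-identityʳ α))
... | g ∷ γ , β↭α+γ | η , α↭β+η = ⊥-elim (m+1+n≢m (length β) (sym (begin
  length β                                   ≡⟨ ↭-length β↭α+γ ⟩
  length (α ++ g ∷ γ)                        ≡⟨ length-++ α ⟩
  length α + suc (length γ)                  ≡⟨ cong (_+ suc (length γ)) (trans (↭-length α↭β+η) (length-++ β)) ⟩
  length β + length η + suc (length γ)      ≡⟨ +-assoc (length β) _ _ ⟩
  length β + (length η + suc (length γ))    ≡⟨ cong (length β +_) (+-suc (length η) _) ⟩
  length β + suc (length η + length γ)      ∎)))

rootCount-firings : ∀ vs → rootCount vs ≡ firings root vs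
rootCount-firings []       = refl
rootCount-firings (v ∷ vs) = cong₂ _+_ (trans (ind-≟V v root) (δ-sym-root v)) (rootCount-firings vs)
  where
  δ-sym-root : ∀ v → δ v root ≡ δ root v
  δ-sym-root []      = refl
  δ-sym-root (_ ∷ _) = refl

rootCount-↭ : α ↭ β → rootCount α ≡ rootCount β
rootCount-↭ {α} {β} α↭β = begin
  rootCount α     ≡⟨ rootCount-firings α ⟩
  firings root α  ≡⟨ sum-↭ (map⁺ (δ root) α↭β) ⟩
  firings root β  ≡⟨ rootCount-firings β ⟨
  rootCount β     ∎

rootCount-++ : ∀ α β → rootCount (α ++ β) ≡ rootCount α + rootCount β
rootCount-++ []      β = refl
rootCount-++ (v ∷ α) β = trans (cong (ind (v ≟V root) +_) (rootCount-++ α β))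
                               (sym (+-assoc (ind (v ≟V root)) (rootCount α) (rootCount β)))

rootCount-replicate : ∀ n → rootCount (replicate n root) ≡ n
rootCount-replicate zero    = refl
rootCount-replicate (suc n) = cong suc (rootCount-replicate n)

-- The copy of v in the subtree of the root's child b is v ∷ʳ b (vertices list their last
-- step first); dropFirstStep sends it back to v.
dropFirstStep : Vertex → Vertex
dropFirstStep []          = []
dropFirstStep (_ ∷ [])    = []
dropFirstStep (a ∷ b ∷ v) = a ∷ dropFirstStep (b ∷ v)

dropFirstStep-∷ʳ : ∀ v b → dropFirstStep (v ∷ʳ b) ≡ v
dropFirstStep-∷ʳ []          _ = refl
dropFirstStep-∷ʳ (_ ∷ [])    _ = refl
dropFirstStep-∷ʳ (a ∷ a′ ∷ v) b = cong (a ∷_) (dropFirstStep-∷ʳ (a′ ∷ v) b)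

δ-root-∷ʳ : ∀ v b → δ root (v ∷ʳ b) ≡ 0
δ-root-∷ʳ []      _ = refl
δ-root-∷ʳ (_ ∷ _) _ = refl

δ-∷ʳ : ∀ a u v → δ (a ∷ u) (v ∷ʳ false) + δ (a ∷ u) (v ∷ʳ true) ≡ δ (dropFirstStep (a ∷ u)) v
δ-∷ʳ false []       []      = refl
δ-∷ʳ true  []       []      = refl
δ-∷ʳ a     []       (b ∷ v) rewrite δ-root-∷ʳ v false | δ-root-∷ʳ v true | *-zeroʳ (δᵇ a b) = refl
δ-∷ʳ false (_ ∷ _)  []      = refl
δ-∷ʳ true  (_ ∷ _)  []      = refl
δ-∷ʳ a     (a′ ∷ u) (b ∷ v) =
  trans (sym (*-distribˡ-+ (δᵇ a b) _ _)) (cong (δᵇ a b *_) (δ-∷ʳ a′ u v))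

record Doubles (r : ℕ) (c d : Config) : Set where
  field
    at-root : d root ≡ r
    at-copy : ∀ a u → d (a ∷ u) ≡ c (dropFirstStep (a ∷ u))

open Doubles

doubles-copy : Doubles r c d → ∀ v b → d (v ∷ʳ b) ≡ c v
doubles-copy D []      b = at-copy D b []
doubles-copy {c = c} D (a ∷ v) b = trans (at-copy D a (v ∷ʳ b)) (cong c (dropFirstStep-∷ʳ (a ∷ v) b))

doubles-stable : r < 3 → Doubles r c d → Stable c → Stable d
doubles-stable r<3 D stable []      = subst (_< 3) (sym (at-root D)) r<3
doubles-stable r<3 D stable (a ∷ u) = subst (_< 3) (sym (at-copy D a u)) (stable _)

initial-δ : ∀ n x → initial n x ≡ n * δ x root
initial-δ n []      = sym (*-identityʳ n)
initial-δ n (_ ∷ _) = sym (*-zeroʳ n)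

sum-map-replicate : ∀ {A : Set} (f : A → ℕ) n a → sum (map f (replicate n a)) ≡ n * f a
sum-map-replicate f zero    a = refl
sum-map-replicate f (suc n) a = cong (f a +_) (sum-map-replicate f n a)

replicate-root-legal : ∀ m → 1 ≤ r → c root ≡ r + 2 * m → Legal c (replicate m root)
replicate-root-legal zero    _   _  = _
replicate-root-legal {r} {c} (suc m) r≥1 eq = c≥3 , replicate-root-legal m r≥1 fired
  where
  c≥3 : 3 ≤ c root
  c≥3 = subst (3 ≤_) (sym eq) (+-mono-≤ r≥1 (*-monoʳ-≤ 2 (s≤s z≤n)))
  fired : fire root c root ≡ r + 2 * m
  fired = +-cancelʳ-≡ 3 _ _ (begin
    fire root c root + 3    ≡⟨ fire-balance {c = c} {v = root} c≥3 root ⟩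
    c root + 1              ≡⟨ cong (_+ 1) eq ⟩
    r + 2 * suc m + 1       ≡⟨ shuffle r m ⟩
    r + 2 * m + 3           ∎)
    where
    shuffle : ∀ r m → r + 2 * suc m + 1 ≡ r + 2 * m + 3
    shuffle = solve-∀

gain-root-copy : ∀ a u → gain root (a ∷ u) ≡ δ (dropFirstStep (a ∷ u)) root
gain-root-copy a u = trans (gain-δ root (a ∷ u)) (trans (+-identityʳ _) (δ-∷ʳ a u []))

initial-doubles : ∀ m → 1 ≤ r →
                  Doubles r (initial m) (apply (replicate m root) (initial (r + 2 * m)))
initial-doubles {r} m r≥1 = record { at-root = at-root′ ; at-copy = at-copy′ }
  where
  d₀ = apply (replicate m root) (initial (r + 2 * m))
  balance = apply-balance (replicate-root-legal m r≥1 refl)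

  at-root′ : d₀ root ≡ r
  at-root′ = +-cancelʳ-≡ (3 * (m * 1)) _ _ (begin
    d₀ root + 3 * (m * 1)                          ≡⟨ cong (λ p → d₀ root + 3 * p) (sum-map-replicate (δ root) m root) ⟨
    d₀ root + 3 * firings root (replicate m root)  ≡⟨ balance root ⟩
    r + 2 * m + inflow (replicate m root) root     ≡⟨ cong (r + 2 * m +_) (sum-map-replicate (λ v → gain v root) m root) ⟩
    r + 2 * m + m * 1                              ≡⟨ shuffle r m ⟩
    r + 3 * (m * 1)                                ∎)
    where
    shuffle : ∀ r m → r + 2 * m + m * 1 ≡ r + 3 * (m * 1)
    shuffle = solve-∀

  at-copy′ : ∀ a u → d₀ (a ∷ u) ≡ initial m (dropFirstStep (a ∷ u))
  at-copy′ a u = begin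
    d₀ y                                     ≡⟨ +-identityʳ (d₀ y) ⟨
    d₀ y + 3 * 0                             ≡⟨ cong (λ p → d₀ y + 3 * p) (trans (sum-map-replicate (δ y) m root) (*-zeroʳ m)) ⟨
    d₀ y + 3 * firings y (replicate m root)  ≡⟨ balance y ⟩
    inflow (replicate m root) y              ≡⟨ sum-map-replicate (λ v → gain v y) m root ⟩
    m * gain root y                          ≡⟨ cong (m *_) (gain-root-copy a u) ⟩
    m * δ (dropFirstStep y) root             ≡⟨ initial-δ m (dropFirstStep y) ⟨
    initial m (dropFirstStep y)              ∎
    where
    y = a ∷ u

-- Simulating the smaller game

-- Firing v is simulated by firing both of its copies; when v is the root, the copies send
-- their two parent chips to the root, which then fires once to hand them back.
lift : Vertex → List Vertex
lift []          = [ false ] ∷ [ true ] ∷ root ∷ []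
lift v@(_ ∷ _)   = v ∷ʳ false ∷ v ∷ʳ true ∷ []

rootCount-lift : ∀ α → rootCount (concatMap lift α) ≡ rootCount α
rootCount-lift []            = refl
rootCount-lift ([] ∷ α)      = cong suc (rootCount-lift α)
rootCount-lift ((_ ∷ _) ∷ α) = rootCount-lift α

lift-firings-copy : ∀ a u v → firings (a ∷ u) (lift v) ≡ δ (dropFirstStep (a ∷ u)) v
lift-firings-copy a u []         = trans (cong (δ (a ∷ u) [ false ] +_) (+-identityʳ _)) (δ-∷ʳ a u [])
lift-firings-copy a u v@(_ ∷ _)  = trans (cong (δ (a ∷ u) (v ∷ʳ false) +_) (+-identityʳ _)) (δ-∷ʳ a u v)

lift-inflow-root : ∀ v → inflow (lift v) root ≡ 3 * firings root (lift v)
lift-inflow-root []          = refl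
lift-inflow-root (_ ∷ [])    = refl
lift-inflow-root (_ ∷ _ ∷ _) = refl

copies-gain : ∀ a u v → let y = a ∷ u in
  (δ y ((false ∷ v) ∷ʳ false) + δ y ((false ∷ v) ∷ʳ true)) +
  (δ y ((true ∷ v) ∷ʳ false) + δ y ((true ∷ v) ∷ʳ true)) +
  (δ y (parent v ∷ʳ false) + δ y (parent v ∷ʳ true))
  ≡ gain v (dropFirstStep y)
copies-gain a u v = trans (cong₂ _+_ (cong₂ _+_ (δ-∷ʳ a u (false ∷ v)) (δ-∷ʳ a u (true ∷ v))) (δ-∷ʳ a u (parent v)))
                          (sym (gain-δ v (dropFirstStep (a ∷ u))))

lift-inflow-copy : ∀ a u v → inflow (lift v) (a ∷ u) ≡ gain v (dropFirstStep (a ∷ u))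
lift-inflow-copy a u [] = begin
  inflow (lift []) y
    ≡⟨ cong₂ _+_ (gain-δ [ false ] y) (cong₂ (λ q s → q + (s + 0)) (gain-δ [ true ] y) (gain-δ root y)) ⟩
  _ ≡⟨ regroup (δ y (false ∷ [ false ])) (δ y (true ∷ [ false ])) (δ y (false ∷ [ true ]))
               (δ y (true ∷ [ true ])) (δ y [ false ]) (δ y [ true ]) ⟩
  _ ≡⟨ copies-gain a u [] ⟩
  gain [] (dropFirstStep y) ∎
  where
  y = a ∷ u
  regroup : ∀ p q p′ q′ s t → (p + q + 0) + ((p′ + q′ + 0) + ((s + t + 0) + 0)) ≡
                             (p + p′) + (q + q′) + (s + t)
  regroup = solve-∀
lift-inflow-copy a u v@(_ ∷ w) = begin
  inflow (lift v) y
    ≡⟨ cong₂ (λ p q → p + (q + 0)) (gain-δ (v ∷ʳ false) y) (gain-δ (v ∷ʳ true) y) ⟩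
  _ ≡⟨ regroup (δ y ((false ∷ v) ∷ʳ false)) (δ y ((true ∷ v) ∷ʳ false)) (δ y (w ∷ʳ false))
               (δ y ((false ∷ v) ∷ʳ true)) (δ y ((true ∷ v) ∷ʳ true)) (δ y (w ∷ʳ true)) ⟩
  _ ≡⟨ copies-gain a u v ⟩
  gain v (dropFirstStep y) ∎
  where
  y = a ∷ u
  regroup : ∀ p q s p′ q′ s′ → (p + q + s) + ((p′ + q′ + s′) + 0) ≡ (p + p′) + (q + q′) + (s + s′)
  regroup = solve-∀

copies-legal : Doubles r c d → 3 ≤ c v → 3 ≤ d (v ∷ʳ false) × 3 ≤ fire (v ∷ʳ false) d (v ∷ʳ true)
copies-legal {d = d} {v = v} D c≥3 =
  subst (3 ≤_) (sym (doubles-copy D v false)) c≥3 ,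
  ≤-trans (subst (3 ≤_) (sym (doubles-copy D v true)) c≥3)
          (fire-mono {c = d} (λ eq → true≢false (∷ʳ-injectiveʳ v v eq)))
  where
  true≢false : true ≢ false
  true≢false ()

lift-legal : 1 ≤ r → Doubles r c d → 3 ≤ c v → Legal d (lift v)
lift-legal {v = []} r≥1 D c≥3 =
  let left , right = copies-legal D c≥3
  in  left , right , subst (3 ≤_) (sym (cong (λ p → p + 1 + 1) (at-root D))) (+-monoˡ-≤ 1 (+-monoˡ-≤ 1 r≥1)) , _
lift-legal {v = _ ∷ _} r≥1 D c≥3 =
  let left , right = copies-legal D c≥3
  in  left , right , _

lift-step : 1 ≤ r → Doubles r c d → 3 ≤ c v →
            Legal d (lift v) × Doubles r (fire v c) (apply (lift v) d)
lift-step {r} {c} {d} {v} r≥1 D c≥3 = legal , record { at-root = at-root′ ; at-copy = at-copy′ }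
  where
  legal = lift-legal r≥1 D c≥3
  d′ = apply (lift v) d

  at-root′ : d′ root ≡ r
  at-root′ = +-cancelʳ-≡ (3 * firings root (lift v)) _ _
    (trans (apply-balance legal root) (cong₂ _+_ (at-root D) (lift-inflow-root v)))

  at-copy′ : ∀ a u → d′ (a ∷ u) ≡ fire v c (dropFirstStep (a ∷ u))
  at-copy′ a u = +-cancelʳ-≡ (3 * δ z v) _ _ (begin
    d′ y + 3 * δ z v                ≡⟨ cong (λ p → d′ y + 3 * p) (lift-firings-copy a u v) ⟨
    d′ y + 3 * firings y (lift v)   ≡⟨ apply-balance legal y ⟩
    d y + inflow (lift v) y         ≡⟨ cong₂ _+_ (at-copy D a u) (lift-inflow-copy a u v) ⟩
    c z + gain v z                  ≡⟨ fire-balance c≥3 z ⟨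
    fire v c z + 3 * δ z v          ∎)
    where
    y = a ∷ u
    z = dropFirstStep y

lift-run : 1 ≤ r → Doubles r c d → Legal c α →
           Legal d (concatMap lift α) × Doubles r (apply α c) (apply (concatMap lift α) d)
lift-run {α = []}    _   D _             = _ , D
lift-run {r} {d = d} {α = v ∷ α} r≥1 D (c≥3 , legal) =
  let legal₁ , D₁ = lift-step r≥1 D c≥3
      legal₂ , D₂ = lift-run r≥1 D₁ legal
  in  legal-++ legal₁ legal₂ , subst (Doubles r _) (sym (apply-++ (lift v) (concatMap lift α) d)) D₂

rootFires-unique : RootFires n k → RootFires n k′ → k ≡ k′
rootFires-unique (_ , _ , run , stable , refl) (_ , _ , run′ , stable′ , refl) =
  rootCount-↭ (stabilising-↭ (run⇒legal run) (run⇒legal run′)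
                             (subst Stable (run⇒apply run) stable) (subst Stable (run⇒apply run′) stable′))

initial-stable : n < 3 → Stable (initial n)
initial-stable n<3 v with v ≟V root
... | yes _ = n<3
... | no  _ = s≤s z≤n

rootFires-small : n < 3 → RootFires n 0
rootFires-small n<3 = [] , _ , done , initial-stable n<3 , refl

rootFires-double : ∀ {m} → 1 ≤ r → r ≤ 2 → RootFires m k → RootFires (r + 2 * m) (m + k)
rootFires-double {r} {m = m} r≥1 r≤2 (α , _ , run , stable , refl) =
  let legal , D = lift-run r≥1 (initial-doubles m r≥1) (run⇒legal run)
  in  replicate m root ++ concatMap lift α , _ ,
      legal⇒run (legal-++ (replicate-root-legal m r≥1 refl) legal) ,
      subst Stable (sym (apply-++ (replicate m root) (concatMap lift α) (initial (r + 2 * m))))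
            (doubles-stable (s≤s r≤2) D (subst Stable (run⇒apply run) stable)) ,
      trans (rootCount-++ (replicate m root) (concatMap lift α))
            (cong₂ _+_ (rootCount-replicate m) (rootCount-lift α))

parity : ∀ n → ∃[ b ] (b ≤ 1 × n ≡ b + 2 * ⌊ n /2⌋)
parity zero          = 0 , z≤n , refl
parity (suc zero)    = 1 , ≤-refl , refl
parity (suc (suc n)) =
  let b , b≤1 , eq = parity n
  in  b , b≤1 , trans (cong (2 +_) eq) (shuffle b ⌊ n /2⌋)
  where
  shuffle : ∀ b h → 2 + (b + 2 * h) ≡ b + 2 * suc h
  shuffle = solve-∀

rootFires-halving : RootFires ⌊ n /2⌋ k → RootFires (suc n) (⌊ n /2⌋ + k)
rootFires-halving {n} {k} rf =
  let b , b≤1 , eq = parity n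
  in  subst (λ N → RootFires N (⌊ n /2⌋ + k)) (cong suc (sym eq)) (rootFires-double (s≤s z≤n) (s≤s b≤1) rf)

rootFires-exists : ∀ n → ∃[ k ] RootFires n k
rootFires-exists = <-rec _ go
  where
  go : ∀ n → (∀ {m} → m < n → ∃[ k ] RootFires m k) → ∃[ k ] RootFires n k
  go zero    _   = 0 , rootFires-small (s≤s z≤n)
  go (suc n) rec = let _ , rf = rec (s≤s (⌊n/2⌋≤n n)) in _ , rootFires-halving rf

rootFires-recursion : ∀ n k → RootFires (suc n) k ⇔ (∃[ k′ ] (RootFires ⌊ n /2⌋ k′ × k ≡ ⌊ n /2⌋ + k′))
rootFires-recursion n k = mk⇔ to from
  where
  from : ∃[ k′ ] (RootFires ⌊ n /2⌋ k′ × k ≡ ⌊ n /2⌋ + k′) → RootFires (suc n) k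
  from (_ , rf , refl) = rootFires-halving rf
  to : RootFires (suc n) k → ∃[ k′ ] (RootFires ⌊ n /2⌋ k′ × k ≡ ⌊ n /2⌋ + k′)
  to rf = let k′ , rf′ = rootFires-exists ⌊ n /2⌋
          in  k′ , rf′ , rootFires-unique rf (rootFires-halving rf′)

mainTheorem16 : ((k : ℕ) → RootFires 1 k ⇔ k ≡ 0)
    × ((N : ℕ) → 3 ≤ N → (k : ℕ) →
        RootFires N k ⇔ (∃[ k' ] (RootFires (⌈ N /2⌉ ∸ 1) k' × k ≡ (⌈ N /2⌉ ∸ 1) + k')))
mainTheorem16 = one , recursion
  where
  one : (k : ℕ) → RootFires 1 k ⇔ k ≡ 0
  one k = mk⇔ (λ rf → rootFires-unique rf (rootFires-small (s≤s (s≤s z≤n))))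
              (λ { refl → rootFires-small (s≤s (s≤s z≤n)) })
  -- ⌈ suc n /2⌉ ∸ 1 is ⌊ n /2⌋ by computation; the recursion holds for every N ≥ 1.
  recursion : (N : ℕ) → 3 ≤ N → (k : ℕ) →
              RootFires N k ⇔ (∃[ k' ] (RootFires (⌈ N /2⌉ ∸ 1) k' × k ≡ (⌈ N /2⌉ ∸ 1) + k'))
  recursion zero    ()
  recursion (suc n) _ = rootFires-recursion n
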